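{- Let $p$ be an odd prime, $t\in\mathbb{N}$, $y,a_1,\dots,a_t\in\mathbb{Z}_p$ and $x_j=\overline{(x_{jk})}_k\in\mathbb{Z}_p^\times$ for $1\le j\le t$. Let $\alpha_1\in\mathbb{Z}$ be such that (i) $g(\alpha_1):=\sum_{j=1}^t a_jx_j^{\alpha_1}\equiv y\pmod p$, and (ii) $\sum_{j=1}^t a_j\,e_2(x_{j2})\,x_j^{\alpha_1}\not\equiv 0\pmod p$. Then there exists a unique $\alpha=\overline{(\alpha_1,\alpha_2,\dots)}\in\mathcal{E}_p$ (i.e. with first coordinate $\alpha_1$) such that $g(\alpha)=\sum_{j=1}^ta_jx_j^{\alpha}=y$ in $\mathbb{Z}_p$.
   Context: $\mathbb{Z}_p$ is modeled as the set of sequences $(a_k)_{k\in\mathbb{N}}$ of integers with $a_{k+1}\equiv a_k\pmod{p^k}$, modulo $a_k\equiv b_k\pmod{p^k}$ for all $k$, coordinatewise operations; units: $p\nmid a_1$; congruence modulo $p$ of an element of $\mathbb{Z}_p$ refers to its first coordinate. $\mathcal{E}_p$ is the set of sequences $(\alpha_k)_{k\in\mathbb{N}}$ of integers with $\alpha_{k+1}\equiv\alpha_k\pmod{\varphi(p^k)}$, modulo $\alpha_k\equiv\beta_k\pmod{\varphi(p^k)}$ for all $k$ ($\varphi$ = Euler's totient). For $a=\overline{(a_k)}\in\mathbb{Z}_p^\times$ and $\alpha=\overline{(\alpha_k)}\in\mathcal{E}_p$, $a^\alpha:=\overline{(a_k^{\alpha_k})}$; integers are embedded as constant sequences. $e_2:(\mathbb{Z}/p^2\mathbb{Z})^\times\to\mathbb{Z}/p\mathbb{Z}$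 is defined by $x^{p-1}\equiv 1+p\,e_2(x)\pmod{p^2}$. -}

module Defs where

open import Data.Nat as ℕ using (ℕ; zero; suc)
open import Data.Nat.GCD using (gcd)
open import Data.Nat.Properties using () renaming (_≟_ to _≟ℕ_)
open import Data.Integer as ℤ using (ℤ; +_; _-_; _*_; _+_; _^_)
open import Data.Integer.DivMod using (_/ℕ_; _%ℕ_)
open import Data.Integer.Divisibility using (_∣_)
open import Data.Fin using (Fin; zero; suc)
open import Data.List using (List; length; filter; upTo)
open import Relation.Binary.PropositionalEquality using (_≡_)
open import Relation.Nullary using (¬_)
open import Data.Product using (_×_)

-- Euler's totient: number of i ∈ {0,…,n-1} with gcd(i,n) = 1  (so φ(1) = 1)
totient : ℕ → ℕ
totient n = length (filter (λ i → gcd i n ≟ℕ 1) (upTo n))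

Cong : ℕ → ℤ → ℤ → Set
Cong m a b = (+ m) ∣ (a - b)

-- sequences of integers indexed by k ∈ ℕ (coordinate k = 0 is a harmless
-- dummy: all conditions at k = 0 are modulo p^0 = 1 resp. φ(p^0) = 1)
Seq : Set
Seq = ℕ → ℤ

IsZp : ℕ → Seq → Set
IsZp p a = ∀ k → Cong (p ℕ.^ k) (a (suc k)) (a k)

ZpEq : ℕ → Seq → Seq → Set
ZpEq p a b = ∀ k → Cong (p ℕ.^ k) (a k) (b k)

IsZpUnit : ℕ → Seq → Set
IsZpUnit p a = IsZp p a × ¬ ((+ p) ∣ a 1)

IsEp : ℕ → Seq → Set
IsEp p α = ∀ k → Cong (totient (p ℕ.^ k)) (α (suc k)) (α k)

EpEq : ℕ → Seq → Seq → Set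
EpEq p α β = ∀ k → Cong (totient (p ℕ.^ k)) (α k) (β k)

const : ℤ → Seq
const c _ = c

-- representative of α modulo d in {0,…,d-1} (d = 0 never occurs for d = φ(p^k))
reduce : ℤ → ℕ → ℕ
reduce α zero    = ℤ.∣ α ∣
reduce α (suc d) = α %ℕ suc d

-- a^α in ℤ_p, coordinatewise: a_k^{α_k} computed in (ℤ/p^kℤ)^×, i.e. with the
-- (possibly negative) exponent α_k replaced by its residue mod φ(p^k)
zpPow : ℕ → Seq → Seq → Seq
zpPow p a α k = a k ^ reduce (α k) (totient (p ℕ.^ k))

sumFin : (t : ℕ) → (Fin t → ℤ) → ℤ
sumFin zero    f = + 0
sumFin (suc t) f = f zero + sumFin t (λ j → f (suc j))

sumSeq : (t : ℕ) → (Fin t → Seq) → Seq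
sumSeq t f k = sumFin t (λ j → f j k)

gFun : ℕ → (t : ℕ) → (Fin t → Seq) → (Fin t → Seq) → Seq → Seq
gFun p t a x α = sumSeq t (λ j k → a j k * zpPow p (x j) α k)

-- exact integer quotient (divisor 0 never used)
quot : ℤ → ℕ → ℤ
quot a zero    = + 0
quot a (suc n) = a /ℕ suc n

-- e_2(x): the integer (x^{p-1} - 1)/p, so that x^{p-1} ≡ 1 + p e_2(x) (mod p^2);
-- only its class mod p is ever used
e2 : ℕ → ℤ → ℤ
e2 p x = quot (x ^ (p ℕ.∸ 1) - + 1) p

{-# OPTIONS --safe #-}
-- Write G_K(n) = Σ_j a_{jK} x_{jK}^n for the K-th coordinate of g at a natural exponent n.
-- For p odd, lifting the exponent gives x^φ(p^{k+1}) ≡ 1 + p^{k+1} e₂(x) (mod p^{k+2}) for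
-- every unit x, hence
--   G_{k+2}(n + i φ(p^{k+1})) ≡ G_{k+2}(n) + i p^{k+1} E  (mod p^{k+2}),
-- where E is the sum in hypothesis (ii). As E is a unit mod p, exactly one digit i mod p
-- turns a solution modulo p^{k+1} into one modulo p^{k+2}. Starting from α₁ this builds the
-- coordinates of α one level at a time, and the uniqueness of every digit forces any other
-- solution β to agree with α at each level.
module Submission where

open import Level using (0ℓ)
import Algebra.Definitions.RawMonoid as RawMonoid
import Algebra.Definitions.RawSemiring as RawSemiring
import Algebra.Properties.CommutativeSemiring.Binomial as Binomial
open import Data.Empty using (⊥-elim)
open import Data.Fin as Fin using (Fin; toℕ; inject₁; fromℕ)
open import Data.Fin.Properties using (toℕ-inject₁; toℕ<n; toℕ-fromℕ)
open import Data.Integer as ℤ using (ℤ; +_; -[1+_]; _+_; _*_; _-_; -_; _^_; 0ℤ; 1ℤ)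
import Data.Integer.Divisibility as ℤD
import Data.Integer.Divisibility.Signed as Signed
open import Data.Integer.DivMod using (_/ℕ_; _%ℕ_; a≡a%ℕn+[a/ℕn]*n; n%ℕd<d)
import Data.Integer.Properties as ℤP
open import Data.Integer.Tactic.RingSolver using (solve-∀)
open import Data.List using ([_]; _++_; length; filter; upTo)
open import Data.List.Properties using (filter-++; filter-accept; filter-reject; filter-≐; length-++; upTo-∷ʳ)
open import Data.Nat as ℕ using (ℕ; zero; suc)
open import Data.Nat.Combinatorics using (_C_; nCn≡1; nC1≡n; nCk+nC[k+1]≡[n+1]C[k+1])
open import Data.Nat.Coprimality using (Coprime; coprime⇒gcd≡1; coprime-divisor)
import Data.Nat.Divisibility as ℕD
open import Data.Nat.Divisibility using () renaming (_∣_ to _∣ℕ_)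
open import Data.Nat.GCD using (gcd; gcd-greatest)
open import Data.Nat.Primality
  using (Prime; euclidsLemma; prime⇒nonZero; prime⇒nonTrivial; prime⇒irreducible; ¬prime[1])
import Data.Nat.Properties as ℕP
import Data.Nat.Tactic.RingSolver as ℕSolver
open import Data.Product using (Σ; ∃-syntax; _×_; _,_; proj₁; proj₂)
open import Data.Sum using (_⊎_; inj₁; inj₂)
open import Function using (_∘_)
open import Relation.Binary.Bundles using (Setoid)
open import Relation.Binary.PropositionalEquality
  using (_≡_; refl; sym; trans; cong; cong₂; subst; module ≡-Reasoning)
import Relation.Binary.Reasoning.Setoid as SetoidReasoning
open import Relation.Nullary using (¬_; ¬?)
open import Relation.Unary using (Pred; Decidable; _≐_)

open import Defs

-- Congruences modulo a natural number

-- Unlike `Cong m a b`, which unfolds to a divisibility of ∣ a - b ∣, this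
-- record determines a and b, so they can be inferred from a proof.
infix 4 _≡_[mod_]
record _≡_[mod_] (a b : ℤ) (m : ℕ) : Set where
  constructor fromCong
  field toCong : Cong m a b
open _≡_[mod_] public

module _ {m : ℕ} where

  ≡mod-intro : ∀ {a b} q → a ≡ b + q * + m → a ≡ b [mod m ]
  ≡mod-intro {b = b} q refl = fromCong (Signed.∣⇒∣ᵤ (Signed.divides q (identity b q (+ m))))
    where identity : ∀ b q m → b + q * m - b ≡ q * m
          identity = solve-∀

  ≡mod-elim : ∀ {a b} → a ≡ b [mod m ] → ∃[ q ] a ≡ b + q * + m
  ≡mod-elim {a} {b} (fromCong m∣a-b) with Signed.∣ᵤ⇒∣ m∣a-b
  ... | Signed.divides q a-b≡qm = q , trans (identity a b) (cong (λ w → b + w) a-b≡qm)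
    where identity : ∀ a b → a ≡ b + (a - b)
          identity = solve-∀

  ≡mod-multiple : ∀ a q → a + q * + m ≡ a [mod m ]
  ≡mod-multiple a q = ≡mod-intro q refl

  ≡mod-multipleˡ : ∀ a q → a + + m * q ≡ a [mod m ]
  ≡mod-multipleˡ a q = ≡mod-intro q (cong (λ v → a + v) (ℤP.*-comm (+ m) q))

  ≡mod-reflexive : ∀ {a b} → a ≡ b → a ≡ b [mod m ]
  ≡mod-reflexive {a} refl = ≡mod-intro 0ℤ (identity a (+ m))
    where identity : ∀ a m → a ≡ a + 0ℤ * m
          identity = solve-∀

  ≡mod-refl : ∀ {a} → a ≡ a [mod m ]
  ≡mod-refl = ≡mod-reflexive refl

  ≡mod-sym : ∀ {a b} → a ≡ b [mod m ] → b ≡ a [mod m ]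
  ≡mod-sym {b = b} a≡b with ≡mod-elim a≡b
  ... | q , refl = ≡mod-intro (- q) (identity b q (+ m))
    where identity : ∀ b q m → b ≡ b + q * m + - q * m
          identity = solve-∀

  ≡mod-trans : ∀ {a b c} → a ≡ b [mod m ] → b ≡ c [mod m ] → a ≡ c [mod m ]
  ≡mod-trans {c = c} a≡b b≡c with ≡mod-elim a≡b | ≡mod-elim b≡c
  ... | q , refl | r , refl = ≡mod-intro (r + q) (identity c r q (+ m))
    where identity : ∀ c r q m → c + r * m + q * m ≡ c + (r + q) * m
          identity = solve-∀

  ≡mod-+ : ∀ {a b c d} → a ≡ b [mod m ] → c ≡ d [mod m ] → a + c ≡ b + d [mod m ]
  ≡mod-+ {b = b} {d = d} a≡b c≡d with ≡mod-elim a≡b | ≡mod-elim c≡d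
  ... | q , refl | r , refl = ≡mod-intro (q + r) (identity b d q r (+ m))
    where identity : ∀ b d q r m → b + q * m + (d + r * m) ≡ b + d + (q + r) * m
          identity = solve-∀

  ≡mod-* : ∀ {a b c d} → a ≡ b [mod m ] → c ≡ d [mod m ] → a * c ≡ b * d [mod m ]
  ≡mod-* {b = b} {d = d} a≡b c≡d with ≡mod-elim a≡b | ≡mod-elim c≡d
  ... | q , refl | r , refl = ≡mod-intro (b * r + q * d + q * r * + m) (identity b d q r (+ m))
    where identity : ∀ b d q r m → (b + q * m) * (d + r * m) ≡ b * d + (b * r + q * d + q * r * m) * m
          identity = solve-∀

  ≡mod-^ : ∀ {a b} n → a ≡ b [mod m ] → a ^ n ≡ b ^ n [mod m ]
  ≡mod-^ zero    a≡b = ≡mod-refl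
  ≡mod-^ (suc n) a≡b = ≡mod-* a≡b (≡mod-^ n a≡b)

  ≡mod-sumFin : ∀ t {f g : Fin t → ℤ} → (∀ j → f j ≡ g j [mod m ]) →
                sumFin t f ≡ sumFin t g [mod m ]
  ≡mod-sumFin zero    f≡g = ≡mod-refl
  ≡mod-sumFin (suc t) f≡g = ≡mod-+ (f≡g Fin.zero) (≡mod-sumFin t (f≡g ∘ Fin.suc))

≡mod-setoid : ℕ → Setoid 0ℓ 0ℓ
≡mod-setoid m = record
  { Carrier       = ℤ
  ; _≈_           = _≡_[mod m ]
  ; isEquivalence = record { refl = ≡mod-refl ; sym = ≡mod-sym ; trans = ≡mod-trans }
  }

module ≡mod-Reasoning (m : ℕ) = SetoidReasoning (≡mod-setoid m)

≡mod-weaken : ∀ {m n a b} → m ℕD.∣ n → a ≡ b [mod n ] → a ≡ b [mod m ]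
≡mod-weaken m∣n (fromCong n∣a-b) = fromCong (ℕD.∣-trans m∣n n∣a-b)

≡mod-1 : ∀ {a b} → a ≡ b [mod 1 ]
≡mod-1 = fromCong (ℕD.1∣ _)

≡mod-0⇒∣ : ∀ {m a} → a ≡ 0ℤ [mod m ] → + m ℤD.∣ a
≡mod-0⇒∣ {m} {a} (fromCong m∣a-0) = subst (λ w → + m ℤD.∣ w) (ℤP.+-identityʳ a) m∣a-0

∣⇒≡mod-0 : ∀ {m} a → + m ℤD.∣ a → a ≡ 0ℤ [mod m ]
∣⇒≡mod-0 {m} a m∣a = fromCong (subst (λ w → + m ℤD.∣ w) (sym (ℤP.+-identityʳ a)) m∣a)

∣-resp-≡mod : ∀ {m a b} → a ≡ b [mod m ] → + m ℤD.∣ a → + m ℤD.∣ b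
∣-resp-≡mod {a = a} a≡b m∣a = ≡mod-0⇒∣ (≡mod-trans (≡mod-sym a≡b) (∣⇒≡mod-0 a m∣a))

≡mod-0-intro : ∀ {m a} q → a ≡ q * + m → a ≡ 0ℤ [mod m ]
≡mod-0-intro q a≡qm = ≡mod-intro q (trans a≡qm (sym (ℤP.+-identityˡ _)))

≡mod-scale : ∀ {m a b} n → a ≡ b [mod m ] → + n * a ≡ + n * b [mod m ℕ.* n ]
≡mod-scale {m} {a} {b} n a≡b with ≡mod-elim a≡b
... | q , refl = ≡mod-intro q (begin
  + n * (b + q * + m)       ≡⟨ identity (+ n) b q (+ m) ⟩
  + n * b + q * (+ m * + n) ≡⟨ cong (λ v → + n * b + q * v) (ℤP.pos-* m n) ⟨
  + n * b + q * + (m ℕ.* n) ∎)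
  where
    open ≡-Reasoning
    identity : ∀ n b q m → n * (b + q * m) ≡ n * b + q * (m * n)
    identity = solve-∀

≡mod-cancel : ∀ {m a b} n .{{_ : ℕ.NonZero n}} → + n * a ≡ + n * b [mod m ℕ.* n ] → a ≡ b [mod m ]
≡mod-cancel {m} {a} {b} n (fromCong mn∣na-nb) =
  fromCong (ℕD.*-cancelʳ-∣ n (subst (m ℕ.* n ℕD.∣_) factor mn∣na-nb))
  where
    identity : ∀ n a b → n * a - n * b ≡ (a - b) * n
    identity = solve-∀
    factor : ℤ.∣ + n * a - + n * b ∣ ≡ ℤ.∣ a - b ∣ ℕ.* n
    factor = trans (cong ℤ.∣_∣ (identity (+ n) a b)) (ℤP.abs-* (a - b) (+ n))

≡mod-+-cancelˡ : ∀ {m} c {a b} → c + a ≡ c + b [mod m ] → a ≡ b [mod m ]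
≡mod-+-cancelˡ {m} c {a} {b} c+a≡c+b = begin
  a              ≡⟨ identity c a ⟩
  - c + (c + a)  ≈⟨ ≡mod-+ (≡mod-refl {a = - c}) c+a≡c+b ⟩
  - c + (c + b)  ≡⟨ identity c b ⟨
  b              ∎
  where
    open ≡mod-Reasoning m
    identity : ∀ c a → a ≡ - c + (c + a)
    identity = solve-∀

pos-+* : ∀ a b c → + (a ℕ.+ b ℕ.* c) ≡ + a + + b * + c
pos-+* a b c = trans (ℤP.pos-+ a (b ℕ.* c)) (cong (λ v → + a + v) (ℤP.pos-* b c))

ℕ-≡mod-multiple : ∀ {d} n i → + (n ℕ.+ i ℕ.* d) ≡ + n [mod d ]
ℕ-≡mod-multiple {d} n i = ≡mod-trans (≡mod-reflexive (pos-+* n i d)) (≡mod-multiple (+ n) (+ i))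

≡mod-ℕ-cases : ∀ {d m n} → + m ≡ + n [mod d ] → ∃[ r ] (m ≡ n ℕ.+ r ℕ.* d ⊎ n ≡ m ℕ.+ r ℕ.* d)
≡mod-ℕ-cases {d} {m} {n} m≡n with ≡mod-elim m≡n
... | + r      , m≡n+rd = r , inj₁ (ℤP.+-injective (trans m≡n+rd (sym (pos-+* n r d))))
... | -[1+ r ] , m≡n-rd =
  suc r , inj₂ (ℤP.+-injective (trans (move {q = -[1+ r ]} {c = + d} m≡n-rd) (sym (pos-+* m (suc r) d))))
  where
    identity : ∀ b q c → b ≡ b + q * c + - q * c
    identity = solve-∀
    move : ∀ {a b q c} → a ≡ b + q * c → b ≡ a + - q * c
    move {b = b} {q} {c} refl = identity b q c

%ℕ-≡mod : ∀ b d .{{_ : ℕ.NonZero d}} → + (b %ℕ d) ≡ b [mod d ]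
%ℕ-≡mod b d = ≡mod-sym (≡mod-intro (b /ℕ d) (a≡a%ℕn+[a/ℕn]*n b d))

reduce-≡mod : ∀ b d → 0 ℕ.< d → + reduce b d ≡ b [mod d ]
reduce-≡mod b (suc d) _ = %ℕ-≡mod b (suc d)

≡mod-digit : ∀ {m a b} d .{{_ : ℕ.NonZero d}} → + a ≡ + b [mod m ] →
             ∃[ i ] + a ≡ + (b ℕ.+ i ℕ.* m) [mod d ℕ.* m ]
≡mod-digit {m} {a} {b} d a≡b with ≡mod-elim a≡b
... | q , a≡b+qm = q %ℕ d , (begin
  + a                      ≡⟨ a≡b+qm ⟩
  + b + q * + m            ≡⟨ cong (λ v → + b + v) (ℤP.*-comm q (+ m)) ⟩
  + b + + m * q            ≈⟨ ≡mod-+ (≡mod-refl {a = + b}) (≡mod-scale m (≡mod-sym (%ℕ-≡mod q d))) ⟩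
  + b + + m * + (q %ℕ d)   ≡⟨ cong (λ v → + b + v) (ℤP.*-comm (+ m) (+ (q %ℕ d))) ⟩
  + b + + (q %ℕ d) * + m   ≡⟨ pos-+* b (q %ℕ d) m ⟨
  + (b ℕ.+ q %ℕ d ℕ.* m)   ∎)
  where open ≡mod-Reasoning (d ℕ.* m)

-- Binomial coefficients and Fermat's little theorem

C-absorption : ∀ n k → suc k ℕ.* (suc n C suc k) ≡ suc n ℕ.* (n C k)
C-absorption zero    zero    = refl
C-absorption zero    (suc k) = ℕP.*-zeroʳ (suc (suc k))
C-absorption (suc n) zero    = trans (ℕP.+-identityʳ _) (trans (nC1≡n (suc (suc n))) (sym (ℕP.*-identityʳ _)))
C-absorption (suc n) (suc k) = begin
  suc (suc k) ℕ.* (suc (suc n) C suc (suc k))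
    ≡⟨ cong (suc (suc k) ℕ.*_) (nCk+nC[k+1]≡[n+1]C[k+1] (suc n) (suc k)) ⟨
  suc (suc k) ℕ.* (suc n C suc k ℕ.+ suc n C suc (suc k))
    ≡⟨ ℕP.*-distribˡ-+ (suc (suc k)) (suc n C suc k) _ ⟩
  suc n C suc k ℕ.+ suc k ℕ.* (suc n C suc k) ℕ.+ suc (suc k) ℕ.* (suc n C suc (suc k))
    ≡⟨ cong₂ (λ u v → suc n C suc k ℕ.+ u ℕ.+ v) (C-absorption n k) (C-absorption n (suc k)) ⟩
  suc n C suc k ℕ.+ suc n ℕ.* (n C k) ℕ.+ suc n ℕ.* (n C suc k)
    ≡⟨ factor (suc n C suc k) (suc n) (n C k) (n C suc k) ⟩
  suc n C suc k ℕ.+ suc n ℕ.* (n C k ℕ.+ n C suc k)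
    ≡⟨ cong (λ c → suc n C suc k ℕ.+ suc n ℕ.* c) (nCk+nC[k+1]≡[n+1]C[k+1] n k) ⟩
  suc (suc n) ℕ.* (suc n C suc k) ∎
  where
    open ≡-Reasoning
    factor : ∀ c m u v → c ℕ.+ m ℕ.* u ℕ.+ m ℕ.* v ≡ c ℕ.+ m ℕ.* (u ℕ.+ v)
    factor = ℕSolver.solve-∀

prime∣pCk : ∀ {p k} → Prime p → 0 ℕ.< k → k ℕ.< p → p ℕD.∣ p C k
prime∣pCk {suc n} {suc k} p-prime _ k<p with euclidsLemma (suc k) (suc n C suc k) p-prime p∣k*pCk
  where p∣k*pCk = ℕD.divides (n C k) (trans (C-absorption n k) (ℕP.*-comm (suc n) (n C k)))
... | inj₁ p∣k   = ⊥-elim (ℕP.<⇒≱ k<p (ℕD.∣⇒≤ p∣k))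
... | inj₂ p∣pCk = p∣pCk

private
  module ℤBinomial = Binomial ℤP.+-*-commutativeSemiring

  ×≡* : ∀ n x → RawMonoid._×_ ℤ.+-0-rawMonoid n x ≡ + n * x
  ×≡* zero    x = sym (ℤP.*-zeroˡ x)
  ×≡* (suc n) x = trans (cong (λ w → x + w) (×≡* n x)) (sym (ℤP.suc-* (+ n) x))

  ^≡^ : ∀ x n → RawSemiring._^_ ℤ.+-*-rawSemiring x n ≡ x ^ n
  ^≡^ x zero    = refl
  ^≡^ x (suc n) = cong (x *_) (^≡^ x n)

  binomialTerm≡ : ∀ x y n k →
                  ℤBinomial.binomialTerm x y n k ≡ + (n C toℕ k) * (x ^ toℕ k * y ^ (n ℕ.∸ toℕ k))
  binomialTerm≡ x y n k = trans (×≡* (n C toℕ k) _)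
    (cong (λ w → + (n C toℕ k) * w) (cong₂ _*_ (^≡^ x (toℕ k)) (^≡^ y (n ℕ.∸ toℕ k))))

  binomialTerm-first : ∀ x y n → ℤBinomial.binomialTerm x y n Fin.zero ≡ y ^ n
  binomialTerm-first x y n = trans (binomialTerm≡ x y n Fin.zero) (trans (ℤP.*-identityˡ _) (ℤP.*-identityˡ _))

  binomialTerm-last : ∀ x y n → ℤBinomial.binomialTerm x y n (fromℕ n) ≡ x ^ n
  binomialTerm-last x y n = begin
    ℤBinomial.binomialTerm x y n (fromℕ n) ≡⟨ binomialTerm≡ x y n (fromℕ n) ⟩
    + (n C k) * (x ^ k * y ^ (n ℕ.∸ k))   ≡⟨ cong (λ k → + (n C k) * (x ^ k * y ^ (n ℕ.∸ k))) (toℕ-fromℕ n) ⟩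
    + (n C n) * (x ^ n * y ^ (n ℕ.∸ n))   ≡⟨ cong₂ (λ c e → + c * (x ^ n * y ^ e)) (nCn≡1 n) (ℕP.n∸n≡0 n) ⟩
    + 1 * (x ^ n * 1ℤ)                    ≡⟨ trans (ℤP.*-identityˡ _) (ℤP.*-identityʳ _) ⟩
    x ^ n                                 ∎
    where
      open ≡-Reasoning
      k = toℕ (fromℕ n)

  sum≡mod-last : ∀ {m} n (T : Fin (suc n) → ℤ) → (∀ i → T (inject₁ i) ≡ 0ℤ [mod m ]) →
                 RawMonoid.sum ℤ.+-0-rawMonoid T ≡ T (fromℕ n) [mod m ]
  sum≡mod-last zero    T _    = ≡mod-reflexive (ℤP.+-identityʳ (T Fin.zero))
  sum≡mod-last (suc n) T T≡0 = ≡mod-trans (≡mod-+ (T≡0 Fin.zero) (sum≡mod-last n (T ∘ Fin.suc) (T≡0 ∘ Fin.suc)))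
                                         (≡mod-reflexive (ℤP.+-identityˡ _))

multiple≡mod-0 : ∀ {m c} a → m ℕD.∣ c → + c * a ≡ 0ℤ [mod m ]
multiple≡mod-0 {m} a (ℕD.divides q refl) = ≡mod-0-intro (+ q * a) (begin
  + (q ℕ.* m) * a  ≡⟨ cong (_* a) (ℤP.pos-* q m) ⟩
  + q * + m * a    ≡⟨ identity (+ q) (+ m) a ⟩
  + q * a * + m    ∎)
  where
    open ≡-Reasoning
    identity : ∀ q m a → q * m * a ≡ q * a * m
    identity = solve-∀

freshmans-dream : ∀ {p} → Prime p → ∀ x → (1ℤ + x) ^ p ≡ x ^ p + 1ℤ [mod p ]
freshmans-dream {suc (suc n)} p-prime x = begin
  (1ℤ + x) ^ p                                               ≡⟨ ^≡^ (1ℤ + x) p ⟨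
  RawSemiring._^_ ℤ.+-*-rawSemiring (1ℤ + x) p               ≡⟨ ℤBinomial.theorem p 1ℤ x ⟩
  T Fin.zero + RawMonoid.sum ℤ.+-0-rawMonoid (T ∘ Fin.suc)   ≈⟨ ≡mod-+ (≡mod-refl {a = T Fin.zero}) middle≡0 ⟩
  T Fin.zero + T (fromℕ p)                                   ≡⟨ cong₂ _+_ (binomialTerm-first 1ℤ x p) last≡1 ⟩
  x ^ p + 1ℤ                                                 ∎
  where
    open ≡mod-Reasoning (suc (suc n))
    p = suc (suc n)
    T = ℤBinomial.binomialTerm 1ℤ x p
    last≡1 : T (fromℕ p) ≡ 1ℤ
    last≡1 = trans (binomialTerm-last 1ℤ x p) (ℤP.^-zeroˡ p)
    middle : ∀ i → T (Fin.suc (inject₁ i)) ≡ 0ℤ [mod p ]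
    middle i = subst (λ t → t ≡ 0ℤ [mod p ]) (sym (binomialTerm≡ 1ℤ x p (Fin.suc (inject₁ i))))
                     (multiple≡mod-0 _ (prime∣pCk p-prime ℕ.z<s (ℕ.s≤s i<p-1)))
      where i<p-1 : toℕ (inject₁ i) ℕ.< suc n
            i<p-1 = subst (ℕ._< suc n) (sym (toℕ-inject₁ i)) (toℕ<n i)
    middle≡0 : RawMonoid.sum ℤ.+-0-rawMonoid (T ∘ Fin.suc) ≡ T (fromℕ p) [mod p ]
    middle≡0 = sum≡mod-last (suc n) (T ∘ Fin.suc) middle

fermat : ∀ {p} → Prime p → ∀ x → x ^ p ≡ x [mod p ]
fermat {suc q} p-prime x = begin
  x ^ p      ≈⟨ ≡mod-^ p (≡mod-sym (%ℕ-≡mod x p)) ⟩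
  (+ r) ^ p  ≈⟨ fermatℕ r ⟩
  + r        ≈⟨ %ℕ-≡mod x p ⟩
  x          ∎
  where
    open ≡mod-Reasoning (suc q)
    p = suc q
    r = x %ℕ p
    fermatℕ : ∀ n → (+ n) ^ p ≡ + n [mod p ]
    fermatℕ zero    = ≡mod-reflexive (ℤP.*-zeroˡ (0ℤ ^ q))
    fermatℕ (suc n) = begin
      (1ℤ + + n) ^ p  ≈⟨ freshmans-dream p-prime (+ n) ⟩
      (+ n) ^ p + 1ℤ  ≈⟨ ≡mod-+ (fermatℕ n) ≡mod-refl ⟩
      + n + 1ℤ        ≡⟨ ℤP.+-comm (+ n) 1ℤ ⟩
      + suc n         ∎

≡mod-cancel-unit : ∀ {p a b} → Prime p → ∀ c → ¬ (+ p ℤD.∣ c) → c * a ≡ c * b [mod p ] → a ≡ b [mod p ]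
≡mod-cancel-unit {p} {a} {b} p-prime c p∤c (fromCong p∣ca-cb)
  with euclidsLemma ℤ.∣ c ∣ ℤ.∣ a - b ∣ p-prime (subst (p ℕD.∣_) factor p∣ca-cb)
  where
    identity : ∀ c a b → c * a - c * b ≡ c * (a - b)
    identity = solve-∀
    factor : ℤ.∣ c * a - c * b ∣ ≡ ℤ.∣ c ∣ ℕ.* ℤ.∣ a - b ∣
    factor = trans (cong ℤ.∣_∣ (identity c a b)) (ℤP.abs-* c (a - b))
... | inj₁ p∣c   = ⊥-elim (p∤c p∣c)
... | inj₂ p∣a-b = fromCong p∣a-b

fermat-unit : ∀ {p} → Prime p → ∀ x → ¬ (+ p ℤD.∣ x) → x ^ (p ℕ.∸ 1) ≡ 1ℤ [mod p ]
fermat-unit {suc q} p-prime x p∤x = ≡mod-cancel-unit {a = x ^ q} {b = 1ℤ} p-prime x p∤x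
  (≡mod-trans (fermat p-prime x) (≡mod-reflexive (sym (ℤP.*-identityʳ x))))

≡mod-0⇒exact-/ℕ : ∀ {d a} .{{_ : ℕ.NonZero d}} → a ≡ 0ℤ [mod d ] → a ≡ (a /ℕ d) * + d
≡mod-0⇒exact-/ℕ {d} {a} a≡0 = begin
  a                              ≡⟨ a≡a%ℕn+[a/ℕn]*n a d ⟩
  + (a %ℕ d) + (a /ℕ d) * + d    ≡⟨ cong (λ r → + r + (a /ℕ d) * + d) r≡0 ⟩
  0ℤ + (a /ℕ d) * + d            ≡⟨ ℤP.+-identityˡ _ ⟩
  (a /ℕ d) * + d                 ∎
  where
    open ≡-Reasoning
    d∣r : d ℕD.∣ a %ℕ d
    d∣r = ≡mod-0⇒∣ {a = + (a %ℕ d)} (≡mod-trans (%ℕ-≡mod a d) a≡0)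
    r≡0 : a %ℕ d ≡ 0
    r≡0 with a %ℕ d | d∣r | n%ℕd<d a d
    ... | zero  | _   | _   = refl
    ... | suc r | d∣r | r<d = ⊥-elim (ℕP.<⇒≱ r<d (ℕD.∣⇒≤ d∣r))

e2-exact : ∀ {p} → Prime p → ∀ x → ¬ (+ p ℤD.∣ x) → x ^ (p ℕ.∸ 1) ≡ 1ℤ + + p * e2 p x
e2-exact {suc q} p-prime x p∤x = begin
  x ^ q                         ≡⟨ identity (x ^ q) ⟩
  1ℤ + (x ^ q - 1ℤ)             ≡⟨ cong (λ w → 1ℤ + w) (≡mod-0⇒exact-/ℕ x^q-1≡0) ⟩
  1ℤ + e2 (suc q) x * + suc q   ≡⟨ cong (λ w → 1ℤ + w) (ℤP.*-comm (e2 (suc q) x) (+ suc q)) ⟩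
  1ℤ + + suc q * e2 (suc q) x   ∎
  where
    open ≡-Reasoning
    identity : ∀ y → y ≡ 1ℤ + (y - 1ℤ)
    identity = solve-∀
    x^q-1≡0 : x ^ q - 1ℤ ≡ 0ℤ [mod suc q ]
    x^q-1≡0 = ∣⇒≡mod-0 (x ^ q - 1ℤ) (toCong (fermat-unit p-prime x p∤x))

linear-root : ∀ {p} → Prime p → ∀ {e} → ¬ (+ p ℤD.∣ e) → ∀ r → ∃[ i ] r + + i * e ≡ 0ℤ [mod p ]
linear-root {suc (suc q)} p-prime {e} p∤e r = i , (begin
  r + + i * e            ≈⟨ ≡mod-+ (≡mod-refl {a = r}) (≡mod-* (%ℕ-≡mod (- r * e ^ q) p) (≡mod-refl {a = e})) ⟩
  r + - r * e ^ q * e    ≡⟨ identity r e (e ^ q) ⟩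
  r + - r * (e * e ^ q)  ≈⟨ ≡mod-+ (≡mod-refl {a = r}) (≡mod-* (≡mod-refl {a = - r}) e^[p-1]≡1) ⟩
  r + - r * 1ℤ           ≡⟨ cancel r ⟩
  0ℤ                     ∎)
  where
    open ≡mod-Reasoning (suc (suc q))
    p = suc (suc q)
    i = (- r * e ^ q) %ℕ p
    e^[p-1]≡1 : e * e ^ q ≡ 1ℤ [mod p ]
    e^[p-1]≡1 = fermat-unit p-prime e p∤e
    identity : ∀ r e E → r + - r * E * e ≡ r + - r * (e * E)
    identity = solve-∀
    cancel : ∀ r → r + - r * 1ℤ ≡ 0ℤ
    cancel = solve-∀

-- Euler's totient function at prime powers

module _ {P : Pred ℕ 0ℓ} (P? : Decidable P) where

  countBelow : ℕ → ℕ
  countBelow n = length (filter P? (upTo n))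

  private
    countBelow-suc : ∀ n → countBelow (suc n) ≡ countBelow n ℕ.+ length (filter P? [ n ])
    countBelow-suc n = begin
      length (filter P? (upTo (suc n)))               ≡⟨ cong (length ∘ filter P?) (upTo-∷ʳ n) ⟨
      length (filter P? (upTo n ++ [ n ]))            ≡⟨ cong length (filter-++ P? (upTo n) [ n ]) ⟩
      length (filter P? (upTo n) ++ filter P? [ n ])  ≡⟨ length-++ (filter P? (upTo n)) ⟩
      countBelow n ℕ.+ length (filter P? [ n ])       ∎
      where open ≡-Reasoning

  countBelow-accept : ∀ {n} → P n → countBelow (suc n) ≡ suc (countBelow n)
  countBelow-accept {n} Pn = trans (countBelow-suc n)
    (trans (cong (λ xs → countBelow n ℕ.+ length xs) (filter-accept P? Pn)) (ℕP.+-comm _ 1))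

  countBelow-reject : ∀ {n} → ¬ P n → countBelow (suc n) ≡ countBelow n
  countBelow-reject {n} ¬Pn = trans (countBelow-suc n)
    (trans (cong (λ xs → countBelow n ℕ.+ length xs) (filter-reject P? ¬Pn)) (ℕP.+-identityʳ _))

nonMultiple? : ∀ d → Decidable (λ i → ¬ d ℕD.∣ i)
nonMultiple? d i = ¬? (d ℕD.∣? i)

countNonMultiples : ℕ → ℕ → ℕ
countNonMultiples d = countBelow (nonMultiple? d)

module _ (q : ℕ) where

  private
    p : ℕ
    p = suc q

  countNonMultiples-* : ∀ m → countNonMultiples p (p ℕ.* m) ≡ q ℕ.* m
  countNonMultiples-block : ∀ m r → r ℕ.< p → countNonMultiples p (p ℕ.* m ℕ.+ suc r) ≡ q ℕ.* m ℕ.+ r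

  countNonMultiples-* zero    = trans (cong (countNonMultiples p) (ℕP.*-zeroʳ p)) (sym (ℕP.*-zeroʳ q))
  countNonMultiples-* (suc m) = begin
    countNonMultiples p (p ℕ.* suc m)    ≡⟨ cong (countNonMultiples p) (trans (ℕP.*-suc p m) (ℕP.+-comm p _)) ⟩
    countNonMultiples p (p ℕ.* m ℕ.+ p)  ≡⟨ countNonMultiples-block m q (ℕP.n<1+n q) ⟩
    q ℕ.* m ℕ.+ q                        ≡⟨ trans (ℕP.+-comm _ q) (sym (ℕP.*-suc q m)) ⟩
    q ℕ.* suc m                          ∎
    where open ≡-Reasoning

  countNonMultiples-block m zero _ = begin
    countNonMultiples p (p ℕ.* m ℕ.+ 1)  ≡⟨ cong (countNonMultiples p) (ℕP.+-comm (p ℕ.* m) 1) ⟩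
    countNonMultiples p (suc (p ℕ.* m))  ≡⟨ countBelow-reject (nonMultiple? p) (λ p∤pm → p∤pm (ℕD.m∣m*n m)) ⟩
    countNonMultiples p (p ℕ.* m)        ≡⟨ countNonMultiples-* m ⟩
    q ℕ.* m                              ≡⟨ ℕP.+-identityʳ _ ⟨
    q ℕ.* m ℕ.+ 0                        ∎
    where open ≡-Reasoning
  countNonMultiples-block m (suc r) r<p = begin
    countNonMultiples p (p ℕ.* m ℕ.+ suc (suc r))  ≡⟨ cong (countNonMultiples p) (ℕP.+-suc (p ℕ.* m) (suc r)) ⟩
    countNonMultiples p (suc (p ℕ.* m ℕ.+ suc r))  ≡⟨ countBelow-accept (nonMultiple? p) p∤pm+r ⟩
    suc (countNonMultiples p (p ℕ.* m ℕ.+ suc r))  ≡⟨ cong suc (countNonMultiples-block m r (ℕP.<⇒≤ r<p)) ⟩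
    suc (q ℕ.* m ℕ.+ r)                            ≡⟨ ℕP.+-suc _ r ⟨
    q ℕ.* m ℕ.+ suc r                              ∎
    where
      open ≡-Reasoning
      p∤pm+r : ¬ p ℕD.∣ p ℕ.* m ℕ.+ suc r
      p∤pm+r p∣pm+r = ℕP.<⇒≱ r<p (ℕD.∣⇒≤ (ℕD.∣m+n∣m⇒∣n p∣pm+r (ℕD.m∣m*n m)))

coprime-^ : ∀ {i p} → Coprime i p → ∀ n → Coprime i (p ℕ.^ n)
coprime-^ _   zero    (_ , d∣1)          = ℕD.∣1⇒≡1 d∣1
coprime-^ i⊥p (suc n) {d} (d∣i , d∣p*pⁿ) = coprime-^ i⊥p n (d∣i , coprime-divisor d⊥p d∣p*pⁿ)
  where d⊥p : Coprime d _
        d⊥p (e∣d , e∣p) = i⊥p (ℕD.∣-trans e∣d d∣i , e∣p)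

module _ {p} (p-prime : Prime p) where

  coprime⇔∤ : ∀ k → (λ i → gcd i (p ℕ.^ suc k) ≡ 1) ≐ (λ i → ¬ p ℕD.∣ i)
  coprime⇔∤ k = ∤ , coprime
    where
      ∤ : ∀ {i} → gcd i (p ℕ.^ suc k) ≡ 1 → ¬ p ℕD.∣ i
      ∤ gcd≡1 p∣i = ¬prime[1] (subst Prime (ℕD.∣1⇒≡1 p∣1) p-prime)
        where p∣1 = subst (p ℕD.∣_) gcd≡1 (gcd-greatest p∣i (ℕD.m∣m*n _))
      coprime : ∀ {i} → ¬ p ℕD.∣ i → gcd i (p ℕ.^ suc k) ≡ 1
      coprime p∤i = coprime⇒gcd≡1 (coprime-^ i⊥p (suc k))
        where i⊥p : Coprime _ p
              i⊥p (d∣i , d∣p) with prime⇒irreducible p-prime d∣p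
              ... | inj₁ d≡1  = d≡1
              ... | inj₂ refl = ⊥-elim (p∤i d∣i)

totient-prime-power : ∀ {p} → Prime p → ∀ k → totient (p ℕ.^ suc k) ≡ p ℕ.^ k ℕ.* (p ℕ.∸ 1)
totient-prime-power {suc q} p-prime k = begin
  totient (p ℕ.^ suc k)
    ≡⟨ cong length (filter-≐ coprime? (nonMultiple? p) (coprime⇔∤ p-prime k) (upTo (p ℕ.^ suc k))) ⟩
  countNonMultiples p (p ℕ.* p ℕ.^ k)   ≡⟨ countNonMultiples-* q (p ℕ.^ k) ⟩
  q ℕ.* p ℕ.^ k                         ≡⟨ ℕP.*-comm q _ ⟩
  p ℕ.^ k ℕ.* q                         ∎
  where
    open ≡-Reasoning
    p : ℕ
    p = suc q
    coprime? : Decidable (λ i → gcd i (p ℕ.^ suc k) ≡ 1)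
    coprime? i = gcd i (p ℕ.^ suc k) ℕP.≟ 1

module _ {p} (p-prime : Prime p) where

  private instance
    p≢0 : ℕ.NonZero p
    p≢0 = prime⇒nonZero p-prime

  totient-p^[k+1]>0 : ∀ k → 0 ℕ.< totient (p ℕ.^ suc k)
  totient-p^[k+1]>0 k = subst (0 ℕ.<_) (sym (totient-prime-power p-prime k))
    (ℕP.*-mono-< (ℕP.m^n>0 p k) (ℕP.m<n⇒0<n∸m (ℕ.nonTrivial⇒n>1 p {{prime⇒nonTrivial p-prime}})))

  totient-p^[k+2] : ∀ k → totient (p ℕ.^ suc (suc k)) ≡ p ℕ.* totient (p ℕ.^ suc k)
  totient-p^[k+2] k = begin
    totient (p ℕ.^ suc (suc k))    ≡⟨ totient-prime-power p-prime (suc k) ⟩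
    p ℕ.* p ℕ.^ k ℕ.* (p ℕ.∸ 1)    ≡⟨ ℕP.*-assoc p (p ℕ.^ k) (p ℕ.∸ 1) ⟩
    p ℕ.* (p ℕ.^ k ℕ.* (p ℕ.∸ 1))  ≡⟨ cong (p ℕ.*_) (totient-prime-power p-prime k) ⟨
    p ℕ.* totient (p ℕ.^ suc k)    ∎
    where open ≡-Reasoning

  totient-p^[k+1]∣totient-p^[k+2] : ∀ k → totient (p ℕ.^ suc k) ℕD.∣ totient (p ℕ.^ suc (suc k))
  totient-p^[k+1]∣totient-p^[k+2] k = subst (totient (p ℕ.^ suc k) ℕD.∣_) (sym (totient-p^[k+2] k)) (ℕD.n∣m*n p)

  totient-p∣totient-p^[k+1] : ∀ k → totient (p ℕ.^ 1) ℕD.∣ totient (p ℕ.^ suc k)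
  totient-p∣totient-p^[k+1] zero    = ℕD.∣-refl
  totient-p∣totient-p^[k+1] (suc k) = ℕD.∣-trans (totient-p∣totient-p^[k+1] k) (totient-p^[k+1]∣totient-p^[k+2] k)

-- Powers of 1 + w and lifting the exponent

pow-1+-expansion : ∀ n w → ∃[ S ] (1ℤ + w) ^ n ≡ 1ℤ + + n * w + + (n C 2) * (w * w) + w * w * w * S
pow-1+-expansion zero    w = 0ℤ , identity w
  where identity : ∀ w → 1ℤ ≡ 1ℤ + 0ℤ * w + 0ℤ * (w * w) + w * w * w * 0ℤ
        identity = solve-∀
pow-1+-expansion (suc n) w with pow-1+-expansion n w
... | S , eq = S + + (n C 2) + w * S , (begin
  (1ℤ + w) * (1ℤ + w) ^ n
    ≡⟨ cong ((1ℤ + w) *_) eq ⟩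
  (1ℤ + w) * (1ℤ + + n * w + + (n C 2) * (w * w) + w * w * w * S)
    ≡⟨ identity w (+ n) (+ (n C 2)) S ⟩
  1ℤ + (1ℤ + + n) * w + (+ n + + (n C 2)) * (w * w) + w * w * w * (S + + (n C 2) + w * S)
    ≡⟨ cong (λ c → 1ℤ + (1ℤ + + n) * w + c * (w * w) + w * w * w * (S + + (n C 2) + w * S)) [n+1]C2 ⟩
  1ℤ + + suc n * w + + (suc n C 2) * (w * w) + w * w * w * (S + + (n C 2) + w * S) ∎)
  where
    open ≡-Reasoning
    identity : ∀ w N C S → (1ℤ + w) * (1ℤ + N * w + C * (w * w) + w * w * w * S)
                         ≡ 1ℤ + (1ℤ + N) * w + (N + C) * (w * w) + w * w * w * (S + C + w * S)
    identity = solve-∀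
    [n+1]C2 : + n + + (n C 2) ≡ + (suc n C 2)
    [n+1]C2 = trans (cong (λ c → + c + + (n C 2)) (sym (nC1≡n n))) (cong +_ (nCk+nC[k+1]≡[n+1]C[k+1] n 1))

pow-1+≡1+n* : ∀ {m} n w → + (n C 2) * (w * w) ≡ 0ℤ [mod m ] → w * w * w ≡ 0ℤ [mod m ] →
              (1ℤ + w) ^ n ≡ 1ℤ + + n * w [mod m ]
pow-1+≡1+n* {m} n w C2w²≡0 w³≡0 with pow-1+-expansion n w
... | S , eq = begin
  (1ℤ + w) ^ n                                        ≡⟨ eq ⟩
  1ℤ + + n * w + + (n C 2) * (w * w) + w * w * w * S  ≈⟨ ≡mod-+ (≡mod-+ (≡mod-refl {a = 1ℤ + + n * w}) C2w²≡0)
                                                                (≡mod-* w³≡0 (≡mod-refl {a = S})) ⟩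
  1ℤ + + n * w + 0ℤ + 0ℤ * S                          ≡⟨ identity (1ℤ + + n * w) S ⟩
  1ℤ + + n * w                                        ∎
  where
    open ≡mod-Reasoning m
    identity : ∀ a S → a + 0ℤ + 0ℤ * S ≡ a
    identity = solve-∀

module _ (p k : ℕ) (z : ℤ) where

  private
    P Q w : ℤ
    P = + p
    Q = + (p ℕ.^ k)
    w = + (p ℕ.^ suc k) * z
    w≡PQz : w ≡ P * Q * z
    w≡PQz = cong (_* z) (ℤP.pos-* p (p ℕ.^ k))
    p^[k+2]≡PPQ : + (p ℕ.^ suc (suc k)) ≡ P * (P * Q)
    p^[k+2]≡PPQ = trans (ℤP.pos-* p (p ℕ.^ suc k)) (cong (P *_) (ℤP.pos-* p (p ℕ.^ k)))
    p^[k+3]≡PPPQ : + (p ℕ.^ suc (suc (suc k))) ≡ P * (P * (P * Q))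
    p^[k+3]≡PPPQ = trans (ℤP.pos-* p (p ℕ.^ suc (suc k))) (cong (P *_) p^[k+2]≡PPQ)

  p^[k+1]z-square≡0 : w * w ≡ 0ℤ [mod p ℕ.^ suc (suc k) ]
  p^[k+1]z-square≡0 = ≡mod-0-intro (Q * z * z) (begin
    w * w                              ≡⟨ cong₂ _*_ w≡PQz w≡PQz ⟩
    P * Q * z * (P * Q * z)            ≡⟨ identity P Q z ⟩
    Q * z * z * (P * (P * Q))          ≡⟨ cong (Q * z * z *_) p^[k+2]≡PPQ ⟨
    Q * z * z * + (p ℕ.^ suc (suc k))  ∎)
    where
      open ≡-Reasoning
      identity : ∀ P Q z → P * Q * z * (P * Q * z) ≡ Q * z * z * (P * (P * Q))
      identity = solve-∀

  pow-1+p^[k+1]z-linear : ∀ i → (1ℤ + w) ^ i ≡ 1ℤ + + i * w [mod p ℕ.^ suc (suc k) ]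
  pow-1+p^[k+1]z-linear i = pow-1+≡1+n* i w
    (≡mod-trans (≡mod-* (≡mod-refl {a = + (i C 2)}) p^[k+1]z-square≡0) (≡mod-reflexive (ℤP.*-zeroʳ (+ (i C 2)))))
    (≡mod-* p^[k+1]z-square≡0 (≡mod-refl {a = w}))

  pow-p-1+p^[k+1]z : p ℕD.∣ p C 2 →
                     (1ℤ + w) ^ p ≡ 1ℤ + + (p ℕ.^ suc (suc k)) * z [mod p ℕ.^ suc (suc (suc k)) ]
  pow-p-1+p^[k+1]z (ℕD.divides h pC2≡hp) = ≡mod-trans (pow-1+≡1+n* p w C2w²≡0 w³≡0) (≡mod-reflexive pw≡p^[k+2]z)
    where
      open ≡-Reasoning
      C2w²≡0 : + (p C 2) * (w * w) ≡ 0ℤ [mod p ℕ.^ suc (suc (suc k)) ]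
      C2w²≡0 = ≡mod-0-intro (+ h * Q * z * z) (begin
        + (p C 2) * (w * w)                            ≡⟨ cong₂ (λ c v → c * (v * v)) pC2≡hP w≡PQz ⟩
        + h * P * (P * Q * z * (P * Q * z))            ≡⟨ identity (+ h) P Q z ⟩
        + h * Q * z * z * (P * (P * (P * Q)))          ≡⟨ cong (+ h * Q * z * z *_) p^[k+3]≡PPPQ ⟨
        + h * Q * z * z * + (p ℕ.^ suc (suc (suc k)))  ∎)
        where
          pC2≡hP : + (p C 2) ≡ + h * P
          pC2≡hP = trans (cong +_ pC2≡hp) (ℤP.pos-* h p)
          identity : ∀ H P Q z → H * P * (P * Q * z * (P * Q * z)) ≡ H * Q * z * z * (P * (P * (P * Q)))
          identity = solve-∀
      w³≡0 : w * w * w ≡ 0ℤ [mod p ℕ.^ suc (suc (suc k)) ]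
      w³≡0 = ≡mod-0-intro (Q * Q * z * z * z) (begin
        w * w * w                                        ≡⟨ cong (λ v → v * v * v) w≡PQz ⟩
        P * Q * z * (P * Q * z) * (P * Q * z)            ≡⟨ identity P Q z ⟩
        Q * Q * z * z * z * (P * (P * (P * Q)))          ≡⟨ cong (Q * Q * z * z * z *_) p^[k+3]≡PPPQ ⟨
        Q * Q * z * z * z * + (p ℕ.^ suc (suc (suc k)))  ∎)
        where identity : ∀ P Q z → P * Q * z * (P * Q * z) * (P * Q * z) ≡ Q * Q * z * z * z * (P * (P * (P * Q)))
              identity = solve-∀
      pw≡p^[k+2]z : 1ℤ + P * w ≡ 1ℤ + + (p ℕ.^ suc (suc k)) * z
      pw≡p^[k+2]z = cong (λ v → 1ℤ + v)
                         (trans (sym (ℤP.*-assoc P _ z)) (cong (_* z) (sym (ℤP.pos-* p (p ℕ.^ suc k)))))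

^-+-*-split : ∀ x n i φ → x ^ (n ℕ.+ i ℕ.* φ) ≡ x ^ n * (x ^ φ) ^ i
^-+-*-split x n i φ = trans (ℤP.^-distribˡ-+-* x n (i ℕ.* φ))
  (cong (λ v → x ^ n * v) (trans (cong (x ^_) (ℕP.*-comm i φ)) (sym (ℤP.^-*-assoc x φ i))))

module _ {p} (p-prime : Prime p) (p-odd : ¬ 2 ℕD.∣ p) where

  private
    p∣pC2 : p ℕD.∣ p C 2
    p∣pC2 = prime∣pCk p-prime (ℕ.s≤s ℕ.z≤n) (ℕP.≤∧≢⇒< 2≤p (λ 2≡p → p-odd (ℕD.∣-reflexive 2≡p)))
      where 2≤p = ℕ.nonTrivial⇒n>1 p {{prime⇒nonTrivial p-prime}}

  pow-p^k-lift : ∀ {v e} → v ≡ 1ℤ + + p * e [mod p ℕ.^ 2 ] →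
                 ∀ k → v ^ (p ℕ.^ k) ≡ 1ℤ + + (p ℕ.^ suc k) * e [mod p ℕ.^ suc (suc k) ]
  pow-p^k-lift {v} {e} v≡1+pe zero = begin
    v * 1ℤ                ≡⟨ ℤP.*-identityʳ v ⟩
    v                     ≈⟨ v≡1+pe ⟩
    1ℤ + + p * e          ≡⟨ cong (λ q → 1ℤ + + q * e) (ℕP.*-identityʳ p) ⟨
    1ℤ + + (p ℕ.* 1) * e  ∎
    where open ≡mod-Reasoning (p ℕ.^ 2)
  pow-p^k-lift {v} {e} v≡1+pe (suc k) with ≡mod-elim (pow-p^k-lift v≡1+pe k)
  ... | s , v^pᵏ≡ = begin
    v ^ (p ℕ.^ suc k)                               ≡⟨ ^-p^[k+1] ⟩
    (v ^ (p ℕ.^ k)) ^ p                             ≡⟨ cong (_^ p) (trans v^pᵏ≡ (regroup (suc k))) ⟩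
    (1ℤ + + (p ℕ.^ suc k) * (e + + p * s)) ^ p      ≈⟨ pow-p-1+p^[k+1]z p k (e + + p * s) p∣pC2 ⟩
    1ℤ + + (p ℕ.^ suc (suc k)) * (e + + p * s)      ≡⟨ regroup (suc (suc k)) ⟨
    1ℤ + + (p ℕ.^ suc (suc k)) * e + s * + (p ℕ.^ suc (suc (suc k)))
                                                    ≈⟨ ≡mod-multiple _ s ⟩
    1ℤ + + (p ℕ.^ suc (suc k)) * e                  ∎
    where
      open ≡mod-Reasoning (p ℕ.^ suc (suc (suc k)))
      ^-p^[k+1] : v ^ (p ℕ.^ suc k) ≡ (v ^ (p ℕ.^ k)) ^ p
      ^-p^[k+1] = sym (trans (ℤP.^-*-assoc v (p ℕ.^ k) p) (cong (v ^_) (ℕP.*-comm (p ℕ.^ k) p)))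
      identity : ∀ P Q e s → 1ℤ + Q * e + s * (P * Q) ≡ 1ℤ + Q * (e + P * s)
      identity = solve-∀
      regroup : ∀ j → 1ℤ + + (p ℕ.^ j) * e + s * + (p ℕ.^ suc j) ≡ 1ℤ + + (p ℕ.^ j) * (e + + p * s)
      regroup j = trans (cong (λ q → 1ℤ + + (p ℕ.^ j) * e + s * q) (ℤP.pos-* p (p ℕ.^ j)))
                        (identity (+ p) (+ (p ℕ.^ j)) e s)

  ^totient≡1+p^[k+1]e2 : ∀ {x} y → ¬ (+ p ℤD.∣ y) → x ≡ y [mod p ℕ.^ 2 ] →
                        ∀ k → x ^ totient (p ℕ.^ suc k) ≡ 1ℤ + + (p ℕ.^ suc k) * e2 p y [mod p ℕ.^ suc (suc k) ]
  ^totient≡1+p^[k+1]e2 {x} y p∤y x≡y k = begin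
    x ^ totient (p ℕ.^ suc k)      ≡⟨ cong (x ^_) (trans (totient-prime-power p-prime k) (ℕP.*-comm _ (p ℕ.∸ 1))) ⟩
    x ^ ((p ℕ.∸ 1) ℕ.* p ℕ.^ k)    ≡⟨ ℤP.^-*-assoc x (p ℕ.∸ 1) (p ℕ.^ k) ⟨
    (x ^ (p ℕ.∸ 1)) ^ (p ℕ.^ k)    ≈⟨ pow-p^k-lift x^[p-1]≡1+pe k ⟩
    1ℤ + + (p ℕ.^ suc k) * e2 p y  ∎
    where
      open ≡mod-Reasoning (p ℕ.^ suc (suc k))
      x^[p-1]≡1+pe : x ^ (p ℕ.∸ 1) ≡ 1ℤ + + p * e2 p y [mod p ℕ.^ 2 ]
      x^[p-1]≡1+pe = ≡mod-trans (≡mod-^ (p ℕ.∸ 1) x≡y) (≡mod-reflexive (e2-exact p-prime y p∤y))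

  euler : ∀ x → ¬ (+ p ℤD.∣ x) → ∀ k → x ^ totient (p ℕ.^ k) ≡ 1ℤ [mod p ℕ.^ k ]
  euler x p∤x zero    = ≡mod-1
  euler x p∤x (suc k) = ≡mod-trans (≡mod-weaken (ℕD.n∣m*n p) (^totient≡1+p^[k+1]e2 x p∤x ≡mod-refl k))
                                   (≡mod-multipleˡ 1ℤ (e2 p x))

  ^[n+rφ]≡^n : ∀ x → ¬ (+ p ℤD.∣ x) → ∀ k n r →
               x ^ (n ℕ.+ r ℕ.* totient (p ℕ.^ k)) ≡ x ^ n [mod p ℕ.^ k ]
  ^[n+rφ]≡^n x p∤x k n r = begin
    x ^ (n ℕ.+ r ℕ.* φ)  ≡⟨ ^-+-*-split x n r φ ⟩
    x ^ n * (x ^ φ) ^ r  ≈⟨ ≡mod-* (≡mod-refl {a = x ^ n}) (≡mod-^ r (euler x p∤x k)) ⟩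
    x ^ n * 1ℤ ^ r       ≡⟨ trans (cong (λ v → x ^ n * v) (ℤP.^-zeroˡ r)) (ℤP.*-identityʳ (x ^ n)) ⟩
    x ^ n                ∎
    where
      open ≡mod-Reasoning (p ℕ.^ k)
      φ : ℕ
      φ = totient (p ℕ.^ k)

  ^-cong-totient : ∀ x → ¬ (+ p ℤD.∣ x) → ∀ k {m n} → + m ≡ + n [mod totient (p ℕ.^ k) ] →
                   x ^ m ≡ x ^ n [mod p ℕ.^ k ]
  ^-cong-totient x p∤x k {m} {n} m≡n with ≡mod-ℕ-cases m≡n
  ... | r , inj₁ refl = ^[n+rφ]≡^n x p∤x k n r
  ... | r , inj₂ refl = ≡mod-sym (^[n+rφ]≡^n x p∤x k m r)

-- Roots of congruences that are affine in a digit

module _ {p} (p-prime : Prime p) {e} (p∤e : ¬ (+ p ℤD.∣ e)) (M : ℕ) {c : ℤ} (f : ℕ → ℤ)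
         (f-affine : ∀ i → f i ≡ c + + i * + M * e [mod p ℕ.* M ]) where

  affine-root : ∀ {y} → c ≡ y [mod M ] → ∃[ i ] f i ≡ y [mod p ℕ.* M ]
  affine-root {y} c≡y with ≡mod-elim c≡y
  ... | r , c≡y+rM with linear-root p-prime p∤e r
  ...   | i , r+ie≡0 = i , (begin
    f i                          ≈⟨ f-affine i ⟩
    c + + i * + M * e            ≡⟨ cong (λ v → v + + i * + M * e) c≡y+rM ⟩
    y + r * + M + + i * + M * e  ≡⟨ identity y r (+ M) (+ i) e ⟩
    y + + M * (r + + i * e)      ≈⟨ ≡mod-+ (≡mod-refl {a = y}) (≡mod-scale M r+ie≡0) ⟩
    y + + M * 0ℤ                 ≡⟨ trans (cong (λ v → y + v) (ℤP.*-zeroʳ (+ M))) (ℤP.+-identityʳ y) ⟩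
    y                            ∎)
    where
      open ≡mod-Reasoning (p ℕ.* M)
      identity : ∀ y r M i e → y + r * M + i * M * e ≡ y + M * (r + i * e)
      identity = solve-∀

  affine-root-unique : .{{_ : ℕ.NonZero M}} → ∀ {i j} → f i ≡ f j [mod p ℕ.* M ] → + i ≡ + j [mod p ]
  affine-root-unique {i} {j} fi≡fj = ≡mod-cancel-unit p-prime e p∤e (≡mod-cancel M (≡mod-+-cancelˡ c (begin
    c + + M * (e * + i)  ≡⟨ identity c (+ M) e (+ i) ⟩
    c + + i * + M * e    ≈⟨ ≡mod-sym (f-affine i) ⟩
    f i                  ≈⟨ fi≡fj ⟩
    f j                  ≈⟨ f-affine j ⟩
    c + + j * + M * e    ≡⟨ identity c (+ M) e (+ j) ⟨
    c + + M * (e * + j)  ∎)))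
    where
      open ≡mod-Reasoning (p ℕ.* M)
      identity : ∀ c M e i → c + M * (e * i) ≡ c + i * M * e
      identity = solve-∀

-- The Hensel construction in the exponent

^-∣-^-+ : ∀ p k d → p ℕ.^ k ℕD.∣ p ℕ.^ (k ℕ.+ d)
^-∣-^-+ p k d = ℕD.divides (p ℕ.^ d) (trans (ℕP.^-distribˡ-+-* p k d) (ℕP.*-comm (p ℕ.^ k) (p ℕ.^ d)))

IsZp-step : ∀ {p} s → IsZp p s → ∀ k → s (suc k) ≡ s k [mod p ℕ.^ k ]
IsZp-step s s-Zp k = fromCong (s-Zp k)

IsZp-coherent : ∀ {p} s → IsZp p s → ∀ k d → s (k ℕ.+ d) ≡ s k [mod p ℕ.^ k ]
IsZp-coherent     s s-Zp k zero    = ≡mod-reflexive (cong s (ℕP.+-identityʳ k))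
IsZp-coherent {p} s s-Zp k (suc d) = ≡mod-trans s[k+d+1]≡s[k+d] (IsZp-coherent s s-Zp k d)
  where
    s[k+d+1]≡s[k+d] : s (k ℕ.+ suc d) ≡ s (k ℕ.+ d) [mod p ℕ.^ k ]
    s[k+d+1]≡s[k+d] = subst (λ l → s l ≡ s (k ℕ.+ d) [mod p ℕ.^ k ]) (sym (ℕP.+-suc k d))
                            (≡mod-weaken (^-∣-^-+ p k d) (IsZp-step s s-Zp (k ℕ.+ d)))

sumFin-linear : ∀ t (u v : Fin t → ℤ) c → sumFin t (λ j → u j + c * v j) ≡ sumFin t u + c * sumFin t v
sumFin-linear zero    u v c = identity c
  where identity : ∀ c → 0ℤ ≡ 0ℤ + c * 0ℤ
        identity = solve-∀
sumFin-linear (suc t) u v c = begin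
  u Fin.zero + c * v Fin.zero + sumFin t (λ j → u (Fin.suc j) + c * v (Fin.suc j))
    ≡⟨ cong (λ s → u Fin.zero + c * v Fin.zero + s) (sumFin-linear t (u ∘ Fin.suc) (v ∘ Fin.suc) c) ⟩
  u Fin.zero + c * v Fin.zero + (sumFin t (u ∘ Fin.suc) + c * sumFin t (v ∘ Fin.suc))
    ≡⟨ identity (u Fin.zero) (v Fin.zero) c (sumFin t (u ∘ Fin.suc)) (sumFin t (v ∘ Fin.suc)) ⟩
  u Fin.zero + sumFin t (u ∘ Fin.suc) + c * (v Fin.zero + sumFin t (v ∘ Fin.suc)) ∎
  where
    open ≡-Reasoning
    identity : ∀ u₀ v₀ c U V → u₀ + c * v₀ + (U + c * V) ≡ u₀ + U + c * (v₀ + V)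
    identity = solve-∀

module Hensel {p} (p-prime : Prime p) (p-odd : ¬ 2 ℕD.∣ p) {t} (a x : Fin t → Seq)
              (a-Zp : ∀ j → IsZp p (a j)) (x-unit : ∀ j → IsZpUnit p (x j)) (y : Seq) (y-Zp : IsZp p y) where

  private instance
    p≢0 : ℕ.NonZero p
    p≢0 = prime⇒nonZero p-prime

  G : ℕ → ℕ → ℤ
  G K n = sumFin t (λ j → a j K * x j K ^ n)

  E : ℕ → ℤ
  E n = sumFin t (λ j → a j 1 * e2 p (x j 2) * x j 1 ^ n)

  private
    x-Zp : ∀ j → IsZp p (x j)
    x-Zp j = proj₁ (x-unit j)

    a≡a₁ : ∀ j k → a j (suc k) ≡ a j 1 [mod p ]
    a≡a₁ j k = ≡mod-weaken (ℕD.m∣m*n 1) (IsZp-coherent (a j) (a-Zp j) 1 k)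

    x≡x₁ : ∀ j k → x j (suc k) ≡ x j 1 [mod p ]
    x≡x₁ j k = ≡mod-weaken (ℕD.m∣m*n 1) (IsZp-coherent (x j) (x-Zp j) 1 k)

  x-unit-at : ∀ j k → ¬ (+ p ℤD.∣ x j (suc k))
  x-unit-at j k p∣x = proj₂ (x-unit j) (∣-resp-≡mod (x≡x₁ j k) p∣x)

  G-cong : ∀ k {m n} → + m ≡ + n [mod totient (p ℕ.^ suc k) ] → G (suc k) m ≡ G (suc k) n [mod p ℕ.^ suc k ]
  G-cong k m≡n = ≡mod-sumFin t (λ j → ≡mod-* (≡mod-refl {a = a j (suc k)})
                                             (^-cong-totient p-prime p-odd (x j (suc k)) (x-unit-at j k) (suc k) m≡n))

  gFun≡G : ∀ β k {n} → β (suc k) ≡ + n [mod totient (p ℕ.^ suc k) ] →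
           gFun p t a x β (suc k) ≡ G (suc k) n [mod p ℕ.^ suc k ]
  gFun≡G β k β≡n = G-cong k (≡mod-trans (reduce-≡mod (β (suc k)) _ (totient-p^[k+1]>0 p-prime k)) β≡n)

  G-coherent : ∀ k n → G (suc (suc k)) n ≡ G (suc k) n [mod p ℕ.^ suc k ]
  G-coherent k n = ≡mod-sumFin t (λ j → ≡mod-* (IsZp-step (a j) (a-Zp j) (suc k))
                                               (≡mod-^ n (IsZp-step (x j) (x-Zp j) (suc k))))

  E-cong : ∀ {m n} → + m ≡ + n [mod totient (p ℕ.^ 1) ] → E m ≡ E n [mod p ]
  E-cong m≡n = ≡mod-sumFin t (λ j → ≡mod-* (≡mod-refl {a = a j 1 * e2 p (x j 2)})
    (≡mod-weaken (ℕD.m∣m*n 1) (^-cong-totient p-prime p-odd (x j 1) (x-unit-at j 0) 1 m≡n)))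

  G-affine : ∀ k n i → G (suc (suc k)) (n ℕ.+ i ℕ.* totient (p ℕ.^ suc k))
                     ≡ G (suc (suc k)) n + + i * + (p ℕ.^ suc k) * E n [mod p ℕ.^ suc (suc k) ]
  G-affine k n i = begin
    G K (n ℕ.+ i ℕ.* φ)                           ≈⟨ ≡mod-sumFin t term ⟩
    sumFin t (λ j → a j K * x j K ^ n + c * v j)  ≡⟨ sumFin-linear t (λ j → a j K * x j K ^ n) v c ⟩
    G K n + c * sumFin t v                        ≡⟨ cong (λ w → G K n + w) (ℤP.*-assoc (+ i) P′ (sumFin t v)) ⟩
    G K n + + i * (P′ * sumFin t v)               ≈⟨ ≡mod-+ (≡mod-refl {a = G K n})
                                                             (≡mod-* (≡mod-refl {a = + i}) P′Σv≡P′E) ⟩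
    G K n + + i * (P′ * E n)                      ≡⟨ cong (λ w → G K n + w) (ℤP.*-assoc (+ i) P′ (E n)) ⟨
    G K n + c * E n                               ∎
    where
      open ≡mod-Reasoning (p ℕ.^ suc (suc k))
      K φ : ℕ
      K = suc (suc k)
      φ = totient (p ℕ.^ suc k)
      P′ c : ℤ
      P′ = + (p ℕ.^ suc k)
      c = + i * P′
      v : Fin t → ℤ
      v j = a j K * e2 p (x j 2) * x j K ^ n
      P′Σv≡P′E : P′ * sumFin t v ≡ P′ * E n [mod p ℕ.^ K ]
      P′Σv≡P′E = ≡mod-scale (p ℕ.^ suc k) (≡mod-sumFin t (λ j →
        ≡mod-* (≡mod-* (a≡a₁ j (suc k)) (≡mod-refl {a = e2 p (x j 2)})) (≡mod-^ n (x≡x₁ j (suc k)))))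
      term : ∀ j → a j K * x j K ^ (n ℕ.+ i ℕ.* φ) ≡ a j K * x j K ^ n + c * v j [mod p ℕ.^ K ]
      term j = begin
        a j K * x j K ^ (n ℕ.+ i ℕ.* φ)                         ≡⟨ cong (a j K *_) (^-+-*-split (x j K) n i φ) ⟩
        a j K * (x j K ^ n * (x j K ^ φ) ^ i)                   ≈⟨ ≡mod-* (≡mod-refl {a = a j K})
                                                                           (≡mod-* (≡mod-refl {a = x j K ^ n}) x^φi≡) ⟩
        a j K * (x j K ^ n * (1ℤ + + i * (P′ * e2 p (x j 2))))  ≡⟨ identity (a j K) (x j K ^ n) (+ i) P′ _ ⟩
        a j K * x j K ^ n + c * v j                             ∎
        where
          x^φ≡ : x j K ^ φ ≡ 1ℤ + P′ * e2 p (x j 2) [mod p ℕ.^ K ]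
          x^φ≡ = ^totient≡1+p^[k+1]e2 p-prime p-odd (x j 2) (x-unit-at j 1) (IsZp-coherent (x j) (x-Zp j) 2 k) k
          x^φi≡ : (x j K ^ φ) ^ i ≡ 1ℤ + + i * (P′ * e2 p (x j 2)) [mod p ℕ.^ K ]
          x^φi≡ = ≡mod-trans (≡mod-^ i x^φ≡) (pow-1+p^[k+1]z-linear p k (e2 p (x j 2)) i)
          identity : ∀ A X I P e → A * (X * (1ℤ + I * (P * e))) ≡ A * X + I * P * (A * e * X)
          identity = solve-∀

  module Construction (α₁ : ℤ) (g[α₁]≡y : Cong p (gFun p t a x (const α₁) 1) (y 1))
                      (E[α₁]≢0 : ¬ Cong p (E (reduce α₁ (totient (p ℕ.^ 1)))) (+ 0)) where

    -- Unfolding zpPow, hypotheses (i) and (ii) are statements about G 1 n₁ and E n₁.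
    n₁ : ℕ
    n₁ = reduce α₁ (totient (p ℕ.^ 1))

    private
      E-unit : ¬ (+ p ℤD.∣ E n₁)
      E-unit p∣E = E[α₁]≢0 (toCong (∣⇒≡mod-0 (E n₁) p∣E))

      base : G 1 n₁ ≡ y 1 [mod p ℕ.^ 1 ]
      base = ≡mod-weaken (ℕD.∣-reflexive (ℕP.*-identityʳ p)) (fromCong g[α₁]≡y)

    LiesOver : ℕ → Set
    LiesOver n = + n ≡ + n₁ [mod totient (p ℕ.^ 1) ]

    Solution : ℕ → ℕ → Set
    Solution k n = LiesOver n × G (suc k) n ≡ y (suc k) [mod p ℕ.^ suc k ]

    E-unit-over : ∀ {n} → LiesOver n → ¬ (+ p ℤD.∣ E n)
    E-unit-over n≡n₁ p∣En = E-unit (∣-resp-≡mod (E-cong n≡n₁) p∣En)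

    private
      digit : ∀ k {n} → Solution k n →
              ∃[ i ] G (suc (suc k)) (n ℕ.+ i ℕ.* totient (p ℕ.^ suc k)) ≡ y (suc (suc k)) [mod p ℕ.^ suc (suc k) ]
      digit k {n} (n≡n₁ , Gn≡y) =
        affine-root p-prime {e = E n} (E-unit-over n≡n₁) (p ℕ.^ suc k) {c = G (suc (suc k)) n}
                    (λ i → G (suc (suc k)) (n ℕ.+ i ℕ.* totient (p ℕ.^ suc k))) (G-affine k n)
                    (≡mod-trans (G-coherent k n) (≡mod-trans Gn≡y (≡mod-sym (IsZp-step y y-Zp (suc k)))))

    lift : ∀ k → Σ ℕ (Solution k) → Σ ℕ (Solution (suc k))
    lift k (n , sol) = n ℕ.+ i ℕ.* totient (p ℕ.^ suc k) , (n′≡n₁ , proj₂ (digit k sol))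
      where
        i : ℕ
        i = proj₁ (digit k sol)
        n′≡n₁ : LiesOver (n ℕ.+ i ℕ.* totient (p ℕ.^ suc k))
        n′≡n₁ = ≡mod-trans (≡mod-weaken (totient-p∣totient-p^[k+1] p-prime k) (ℕ-≡mod-multiple n i)) (proj₁ sol)

    lift-≡ : ∀ k s → + proj₁ (lift k s) ≡ + proj₁ s [mod totient (p ℕ.^ suc k) ]
    lift-≡ k (n , sol) = ℕ-≡mod-multiple n (proj₁ (digit k sol))

    lift-unique : ∀ k {n n′} → LiesOver n → + n′ ≡ + n [mod totient (p ℕ.^ suc k) ] →
                  G (suc (suc k)) n ≡ y (suc (suc k)) [mod p ℕ.^ suc (suc k) ] →
                  G (suc (suc k)) n′ ≡ y (suc (suc k)) [mod p ℕ.^ suc (suc k) ] →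
                  + n′ ≡ + n [mod totient (p ℕ.^ suc (suc k)) ]
    lift-unique k {n} {n′} n≡n₁ n′≡n Gn≡y Gn′≡y =
      ≡mod-weaken {n = p ℕ.* φ} (ℕD.∣-reflexive (totient-p^[k+2] p-prime k)) (begin
        + n′               ≈⟨ n′≡n+iφ ⟩
        + (n ℕ.+ i ℕ.* φ)  ≡⟨ trans (pos-+* n i φ) (cong (λ v → + n + v) (ℤP.*-comm (+ i) (+ φ))) ⟩
        + n + + φ * + i    ≈⟨ ≡mod-+ (≡mod-refl {a = + n}) (≡mod-scale φ i≡0) ⟩
        + n + + φ * 0ℤ     ≡⟨ trans (cong (λ v → + n + v) (ℤP.*-zeroʳ (+ φ))) (ℤP.+-identityʳ (+ n)) ⟩
        + n                ∎)
      where
        open ≡mod-Reasoning (p ℕ.* totient (p ℕ.^ suc k))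
        K φ i : ℕ
        K = suc (suc k)
        φ = totient (p ℕ.^ suc k)
        i = proj₁ (≡mod-digit p n′≡n)
        n′≡n+iφ : + n′ ≡ + (n ℕ.+ i ℕ.* φ) [mod p ℕ.* φ ]
        n′≡n+iφ = proj₂ (≡mod-digit p n′≡n)
        f : ℕ → ℤ
        f d = G K (n ℕ.+ d ℕ.* φ)
        n+iφ≡n′ : + (n ℕ.+ i ℕ.* φ) ≡ + n′ [mod totient (p ℕ.^ K) ]
        n+iφ≡n′ = ≡mod-weaken (ℕD.∣-reflexive (totient-p^[k+2] p-prime k)) (≡mod-sym n′≡n+iφ)
        fi≡f0 : f i ≡ f 0 [mod p ℕ.* p ℕ.^ suc k ]
        fi≡f0 = ≡mod-trans (G-cong (suc k) n+iφ≡n′) (≡mod-trans Gn′≡y (≡mod-trans (≡mod-sym Gn≡y)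
                  (≡mod-reflexive (cong (G K) (sym (ℕP.+-identityʳ n))))))
        i≡0 : + i ≡ 0ℤ [mod p ]
        i≡0 = affine-root-unique p-prime {e = E n} (E-unit-over n≡n₁) (p ℕ.^ suc k) {c = G K n} f (G-affine k n)
                                 {{ℕP.m^n≢0 p (suc k)}} fi≡f0

    approx : ∀ k → Σ ℕ (Solution k)
    approx zero    = n₁ , ≡mod-refl , base
    approx (suc k) = lift k (approx k)

    -- Coordinate 0 is a dummy; coordinate 1 must be α₁ itself, which agrees with n₁ only mod φ(p).
    α : Seq
    α zero          = α₁
    α (suc zero)    = α₁
    α (suc (suc k)) = + proj₁ (approx (suc k))

    α≡approx : ∀ k → α (suc k) ≡ + proj₁ (approx k) [mod totient (p ℕ.^ suc k) ]
    α≡approx zero    = ≡mod-sym (reduce-≡mod α₁ _ (totient-p^[k+1]>0 p-prime 0))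
    α≡approx (suc k) = ≡mod-refl

    α-IsEp : IsEp p α
    α-IsEp zero    = ℕD.1∣ _
    α-IsEp (suc k) = toCong (≡mod-trans (lift-≡ k (approx k)) (≡mod-sym (α≡approx k)))

    α-solves : ZpEq p (gFun p t a x α) y
    α-solves zero    = ℕD.1∣ _
    α-solves (suc k) = toCong (≡mod-trans (gFun≡G α k (α≡approx k)) (proj₂ (proj₂ (approx k))))

    α-unique : ∀ β → IsEp p β → Cong (totient p) (β 1) α₁ → ZpEq p (gFun p t a x β) y → EpEq p β α
    α-unique β β-Ep β₁≡α₁ g[β]≡y zero    = ℕD.1∣ _
    α-unique β β-Ep β₁≡α₁ g[β]≡y (suc k) = toCong (≡mod-trans (β≡approx k) (≡mod-sym (α≡approx k)))
      where
        β≡approx : ∀ k → β (suc k) ≡ + proj₁ (approx k) [mod totient (p ℕ.^ suc k) ]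
        β≡approx zero    = ≡mod-trans β₁≡α₁′ (α≡approx 0)
          where β₁≡α₁′ : β 1 ≡ α₁ [mod totient (p ℕ.^ 1) ]
                β₁≡α₁′ = ≡mod-weaken (ℕD.∣-reflexive (cong totient (ℕP.*-identityʳ p)))
                                     (fromCong β₁≡α₁)
        β≡approx (suc k) = ≡mod-trans (≡mod-sym b≡β) (lift-unique k n≡n₁ b≡n Gn≡y G[b]≡y)
          where
            n b : ℕ
            n = proj₁ (approx (suc k))
            b = reduce (β (suc (suc k))) (totient (p ℕ.^ suc (suc k)))
            n≡n₁ : LiesOver n
            n≡n₁ = proj₁ (proj₂ (approx (suc k)))
            Gn≡y : G (suc (suc k)) n ≡ y (suc (suc k)) [mod p ℕ.^ suc (suc k) ]
            Gn≡y = proj₂ (proj₂ (approx (suc k)))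
            G[b]≡y : G (suc (suc k)) b ≡ y (suc (suc k)) [mod p ℕ.^ suc (suc k) ]
            G[b]≡y = fromCong (g[β]≡y (suc (suc k)))
            b≡β : + b ≡ β (suc (suc k)) [mod totient (p ℕ.^ suc (suc k)) ]
            b≡β = reduce-≡mod (β (suc (suc k))) _ (totient-p^[k+1]>0 p-prime (suc k))
            b≡n : + b ≡ + n [mod totient (p ℕ.^ suc k) ]
            b≡n = ≡mod-trans (≡mod-weaken (totient-p^[k+1]∣totient-p^[k+2] p-prime k) b≡β)
                  (≡mod-trans (fromCong (β-Ep (suc k)))
                  (≡mod-trans (β≡approx k) (≡mod-sym (lift-≡ k (approx k)))))

proposition2p9 : (p : ℕ) → Prime p → ¬ (2 ∣ℕ p) →
    (t : ℕ) (y : Seq) (a x : Fin t → Seq) →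
    IsZp p y → (∀ j → IsZp p (a j)) → (∀ j → IsZpUnit p (x j)) →
    (α₁ : ℤ) →
    Cong p (gFun p t a x (const α₁) 1) (y 1) →
    ¬ Cong p (sumFin t (λ j → a j 1 * e2 p (x j 2) * zpPow p (x j) (const α₁) 1)) (+ 0) →
    Σ Seq (λ α → (IsEp p α × α 1 ≡ α₁ × ZpEq p (gFun p t a x α) y)
      × ((β : Seq) → IsEp p β → Cong (totient p) (β 1) α₁ →
         ZpEq p (gFun p t a x β) y → EpEq p β α))
proposition2p9 p p-prime p-odd t y a x y-Zp a-Zp x-unit α₁ g[α₁]≡y E[α₁]≢0 =
  α , (α-IsEp , refl , α-solves) , α-unique
  where open Hensel.Construction p-prime p-odd a x a-Zp x-unit y y-Zp α₁ g[α₁]≡y E[α₁]≢0
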